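{- Let $a,b\in\mathbb{N}$ and let $n$ be a strong alpha number of order $(a,b)$ with $\omega(n)\le 2$. Then $n$ is not a perfect square.
   Context: For a positive integer $n$ and $x\in\mathbb{N}$, $\sigma_x(n)=\sum_{d\mid n} d^x$; $\omega(n)$ is the number of distinct prime divisors of $n$. A positive integer $n$ is a strong alpha number of order $(a,b)$ if there exist coprime positive integers $\alpha_1,\alpha_2$ with $\sigma_a(n)=\frac{\alpha_1}{\alpha_2}n^{b}$ and $2\le \max(\alpha_1,\alpha_2)\le \omega(n)$. -}

module Defs where

open import Data.Nat using (ℕ; zero; suc; _+_; _*_; _^_; _≤_; _<_)
open import Data.Nat.Divisibility using (_∣_; _∣?_)
open import Data.Nat.Primality using (Prime; prime?)
open import Data.Nat.Coprimality using (Coprime)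
open import Data.Nat.GCD using ()
open import Data.List using (List; filter; map; length)
open import Data.Nat.ListAction using (sum)
open import Data.List.Base using (upTo)
open import Data.Product using (Σ; _×_; ∃)
open import Relation.Binary.PropositionalEquality using (_≡_)
open import Relation.Nullary.Decidable using (_×-dec_)

range1 : ℕ → List ℕ
range1 n = map suc (upTo n)

-- σ_x(n) = Σ_{d ∣ n} d^x   (for n ≥ 1 all divisors lie in 1..n)
σ : ℕ → ℕ → ℕ
σ x n = sum (map (λ d → d ^ x) (filter (λ d → d ∣? n) (range1 n)))

ω : ℕ → ℕ
ω n = length (filter (λ p → prime? p ×-dec (p ∣? n)) (range1 n))

max : ℕ → ℕ → ℕ
max = Data.Nat._⊔_

-- n is a strong alpha number of order (a,b):
-- ∃ coprime positive α₁ α₂ with σ_a(n) = (α₁/α₂) n^b, i.e. α₂ σ_a(n) = α₁ n^b,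
-- and 2 ≤ max(α₁,α₂) ≤ ω(n).
StrongAlpha : ℕ → ℕ → ℕ → Set
StrongAlpha a b n =
  1 ≤ n ×
  Σ ℕ λ α₁ → Σ ℕ λ α₂ →
    1 ≤ α₁ × 1 ≤ α₂ × Coprime α₁ α₂ ×
    α₂ * σ a n ≡ α₁ * n ^ b ×
    2 ≤ max α₁ α₂ × max α₁ α₂ ≤ ω n

IsSquare : ℕ → Set
IsSquare n = ∃ λ m → m * m ≡ n

{-# OPTIONS --safe #-}
-- Let n = m². The divisors d, e of a square with d e = n pair off except for
-- d = e = m, so n has an odd number of divisors; for a ≥ 1 we have d^a ≡ d (mod 2), so
-- σ_a(n) has the parity of the number of odd divisors of n, i.e. of the number of divisors
-- of the odd part of n, which is again a square. Hence σ_a(n) is odd. On the other hand,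
-- α₁, α₂ are coprime with 2 ≤ max(α₁, α₂) ≤ ω(n) ≤ 2, so {α₁, α₂} = {1, 2}: either
-- σ_a(n) = 2 n^b is even, or 2 σ_a(n) = (m^b)² is twice an odd number and a square.
module Submission where

open import Defs
open import Data.Nat using (ℕ; zero; suc; _+_; _*_; _^_; _≤_; _<_; _⊔_; _≟_; s≤s; NonZero; >-nonZero; >-nonZero⁻¹)
open import Data.Nat.Properties
open import Data.Nat.DivMod using (_%_; _/_; %-distribˡ-+; %-distribˡ-*; m%n%n≡m%n; m*n%n≡0; m%n<n; m≡m%n+[m/n]*n; [m+kn]%n≡m%n)
open import Data.Nat.Divisibility using (_∣_; _∣?_; divides; ∣-refl; ∣-trans; ∣⇒≤; 0∣⇒≡0; n∣m⇒m%n≡0; m%n≡0⇒n∣m; ∣n⇒∣m*n; quotient≢0)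
open import Data.Nat.Coprimality using (Coprime; coprime-divisor)
open import Data.Nat.Induction using (<-rec)
open import Data.Nat.ListAction using (sum)
open import Data.Nat.Tactic.RingSolver using (solve-∀)
open import Data.List using (List; []; _∷_; map; filter)
open import Data.List.Membership.Propositional using (_∈_; _∉_)
open import Data.List.Membership.Propositional.Properties using (∈-map⁺; ∈-upTo⁺)
open import Data.List.Relation.Unary.Any using (here; there)
open import Data.List.Relation.Unary.All.Properties using (All¬⇒¬Any)
open import Data.List.Relation.Unary.AllPairs using (_∷_)
open import Data.List.Relation.Unary.Unique.Propositional using (Unique)
import Data.List.Relation.Unary.Unique.Propositional.Properties as Unique
open import Data.Product using (∃; ∃₂; _×_; _,_; proj₁; proj₂)
open import Data.Sum using (_⊎_; inj₁; inj₂)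
open import Function using (_∘_; it)
open import Relation.Nullary using (¬_; Dec; yes; no; contradiction)
open import Relation.Unary using (Decidable)
open import Relation.Binary.Definitions using (tri<; tri≈; tri>)
open import Relation.Binary.PropositionalEquality

𝟙 : ∀ {p} {P : Set p} → Dec P → ℕ
𝟙 (yes _) = 1
𝟙 (no _)  = 0

𝟙-cong : ∀ {p q} {P : Set p} {Q : Set q} → (P → Q) → (Q → P) →
         (p? : Dec P) (q? : Dec Q) → 𝟙 p? ≡ 𝟙 q?
𝟙-cong P⇒Q Q⇒P (yes p) (yes q) = refl
𝟙-cong P⇒Q Q⇒P (yes p) (no ¬q) = contradiction (P⇒Q p) ¬q
𝟙-cong P⇒Q Q⇒P (no ¬p) (yes q) = contradiction (Q⇒P q) ¬p
𝟙-cong P⇒Q Q⇒P (no ¬p) (no ¬q) = refl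

𝟙-¬ : ∀ {p} {P : Set p} → ¬ P → (p? : Dec P) → 𝟙 p? ≡ 0
𝟙-¬ ¬p (yes p) = contradiction p ¬p
𝟙-¬ ¬p (no _)  = refl

∑ : List ℕ → (ℕ → ℕ) → ℕ
∑ []       f = 0
∑ (x ∷ xs) f = f x + ∑ xs f

infix 5 ∑
syntax ∑ xs (λ x → e) = ∑[ x ∈ xs ] e

∑-cong : ∀ xs {f g : ℕ → ℕ} → (∀ x → f x ≡ g x) → ∑ xs f ≡ ∑ xs g
∑-cong []       f≗g = refl
∑-cong (x ∷ xs) f≗g = cong₂ _+_ (f≗g x) (∑-cong xs f≗g)

∑-zero : ∀ xs {f : ℕ → ℕ} → (∀ x → f x ≡ 0) → ∑ xs f ≡ 0
∑-zero []       f≗0 = refl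
∑-zero (x ∷ xs) f≗0 = cong₂ _+_ (f≗0 x) (∑-zero xs f≗0)

∑-distrib-+ : ∀ xs (f g : ℕ → ℕ) → ∑[ x ∈ xs ] (f x + g x) ≡ ∑ xs f + ∑ xs g
∑-distrib-+ []       f g = refl
∑-distrib-+ (x ∷ xs) f g rewrite ∑-distrib-+ xs f g = interchange (f x) (g x) (∑ xs f) (∑ xs g)
  where
  interchange : ∀ a b c d → a + b + (c + d) ≡ a + c + (b + d)
  interchange = solve-∀

∑-cong-% : ∀ k .{{_ : NonZero k}} xs {f g : ℕ → ℕ} →
           (∀ x → f x % k ≡ g x % k) → ∑ xs f % k ≡ ∑ xs g % k
∑-cong-% k []       f≡g = refl
∑-cong-% k (x ∷ xs) {f} {g} f≡g = begin
  (f x + ∑ xs f) % k             ≡⟨ %-distribˡ-+ (f x) (∑ xs f) k ⟩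
  (f x % k + ∑ xs f % k) % k     ≡⟨ cong₂ (λ u v → (u + v) % k) (f≡g x) (∑-cong-% k xs f≡g) ⟩
  (g x % k + ∑ xs g % k) % k     ≡⟨ %-distribˡ-+ (g x) (∑ xs g) k ⟨
  (g x + ∑ xs g) % k             ∎
  where open ≡-Reasoning

sum-map-filter : ∀ {P : ℕ → Set} (P? : Decidable P) (g : ℕ → ℕ) xs →
                 sum (map g (filter P? xs)) ≡ ∑[ x ∈ xs ] 𝟙 (P? x) * g x
sum-map-filter P? g []       = refl
sum-map-filter P? g (x ∷ xs) with P? x
... | yes _ = cong₂ _+_ (sym (+-identityʳ (g x))) (sum-map-filter P? g xs)
... | no _  = sum-map-filter P? g xs

∑∑-symmetric : ∀ (S : ℕ → ℕ → ℕ) → (∀ x y → S x y ≡ S y x) → ∀ xs →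
               ∃ λ k → ∑[ x ∈ xs ] ∑ xs (S x) ≡ (∑[ x ∈ xs ] S x x) + k * 2
∑∑-symmetric S S-sym []       = 0 , refl
∑∑-symmetric S S-sym (x ∷ xs) with ∑∑-symmetric S S-sym xs
... | k , eq = ∑ xs (S x) + k , (begin
  S x x + ∑ xs (S x) + (∑[ y ∈ xs ] (S y x + ∑ xs (S y)))
    ≡⟨ cong (S x x + ∑ xs (S x) +_) (∑-distrib-+ xs (λ y → S y x) (λ y → ∑ xs (S y))) ⟩
  S x x + ∑ xs (S x) + ((∑[ y ∈ xs ] S y x) + (∑[ y ∈ xs ] ∑ xs (S y)))
    ≡⟨ cong₂ (λ u v → S x x + ∑ xs (S x) + (u + v)) (∑-cong xs (λ y → S-sym y x)) eq ⟩
  S x x + ∑ xs (S x) + (∑ xs (S x) + ((∑[ y ∈ xs ] S y y) + k * 2))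
    ≡⟨ regroup (S x x) (∑ xs (S x)) (∑[ y ∈ xs ] S y y) k ⟩
  S x x + (∑[ y ∈ xs ] S y y) + (∑ xs (S x) + k) * 2 ∎)
  where
  open ≡-Reasoning
  regroup : ∀ s a d k → s + a + (a + (d + k * 2)) ≡ s + d + (a + k) * 2
  regroup = solve-∀

∑-𝟙-≟-∉ : ∀ {c xs} → c ∉ xs → ∑[ y ∈ xs ] 𝟙 (y ≟ c) ≡ 0
∑-𝟙-≟-∉ {c} {[]}     c∉xs = refl
∑-𝟙-≟-∉ {c} {y ∷ ys} c∉xs with y ≟ c
... | yes y≡c = contradiction (here (sym y≡c)) c∉xs
... | no _    = ∑-𝟙-≟-∉ (c∉xs ∘ there)

∑-𝟙-≟-unique : ∀ {c xs} → Unique xs → c ∈ xs → ∑[ y ∈ xs ] 𝟙 (y ≟ c) ≡ 1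
∑-𝟙-≟-unique {c} {y ∷ ys} (y∉ys ∷ _) (here c≡y) with y ≟ c
... | yes _   = cong suc (∑-𝟙-≟-∉ (subst (_∉ ys) (sym c≡y) (All¬⇒¬Any y∉ys)))
... | no y≢c  = contradiction (sym c≡y) y≢c
∑-𝟙-≟-unique {c} {y ∷ ys} (y∉ys ∷ ys-unique) (there c∈ys) with y ≟ c
... | yes refl = contradiction c∈ys (All¬⇒¬Any y∉ys)
... | no _     = ∑-𝟙-≟-unique ys-unique c∈ys

∑-𝟙-≟-range1 : ∀ {c} L → 1 ≤ c → c ≤ L → ∑[ y ∈ range1 L ] 𝟙 (y ≟ c) ≡ 1
∑-𝟙-≟-range1 {suc c} L _ c<L =
  ∑-𝟙-≟-unique (Unique.map⁺ suc-injective (Unique.upTo⁺ L)) (∈-map⁺ suc (∈-upTo⁺ c<L))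

∑-cofactors : ∀ L {M} .{{_ : NonZero M}} d → M ≤ L →
              ∑[ e ∈ range1 L ] 𝟙 (d * e ≟ M) ≡ 𝟙 (d ∣? M)
∑-cofactors L {M} d M≤L with d ∣? M
... | no d∤M = ∑-zero (range1 L) λ e →
  𝟙-¬ (λ de≡M → d∤M (divides e (trans (sym de≡M) (*-comm d e)))) (d * e ≟ M)
... | yes d∣M@(divides q M≡qd) = begin
  ∑[ e ∈ range1 L ] 𝟙 (d * e ≟ M)  ≡⟨ ∑-cong (range1 L) (λ e → 𝟙-cong (cancel e) (uncancel e) (d * e ≟ M) (e ≟ q)) ⟩
  ∑[ e ∈ range1 L ] 𝟙 (e ≟ q)      ≡⟨ ∑-𝟙-≟-range1 L 1≤q (≤-trans q≤M M≤L) ⟩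
  1                                ∎
  where
  open ≡-Reasoning
  instance
    q≢0 : NonZero q
    q≢0 = quotient≢0 d∣M
    d≢0 : NonZero d
    d≢0 = m*n≢0⇒n≢0 q {{subst NonZero M≡qd it}}
  M≡dq : M ≡ d * q
  M≡dq = trans M≡qd (*-comm q d)
  cancel : ∀ e → d * e ≡ M → e ≡ q
  cancel e de≡M = *-cancelˡ-≡ e q d (trans de≡M M≡dq)
  uncancel : ∀ e → e ≡ q → d * e ≡ M
  uncancel e refl = sym M≡dq
  1≤q : 1 ≤ q
  1≤q = >-nonZero⁻¹ q
  q≤M : q ≤ M
  q≤M = ∣⇒≤ (divides d M≡dq)

m*m≡n*n⇒m≡n : ∀ m n → m * m ≡ n * n → m ≡ n
m*m≡n*n⇒m≡n m n eq with <-cmp m n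
... | tri< m<n _ _ = contradiction eq (<⇒≢ (*-mono-< m<n m<n))
... | tri≈ _ m≡n _ = m≡n
... | tri> _ _ n<m = contradiction (sym eq) (<⇒≢ (*-mono-< n<m n<m))

-- Writing 𝟙 (d ∣? M) as the number of cofactors e with d e = M turns the count into a
-- symmetric double sum, whose parity is that of its diagonal d d = M.
divisorCount-square-odd : ∀ L m .{{_ : NonZero m}} → m * m ≤ L →
                          (∑[ d ∈ range1 L ] 𝟙 (d ∣? m * m)) % 2 ≡ 1
divisorCount-square-odd L m m²≤L = begin
  (∑[ d ∈ D ] 𝟙 (d ∣? m * m)) % 2            ≡⟨ cong (_% 2) (∑-cong D (λ d → ∑-cofactors L d m²≤L)) ⟨
  (∑[ d ∈ D ] ∑ D (S d)) % 2                 ≡⟨ cong (_% 2) (proj₂ pairing) ⟩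
  ((∑[ d ∈ D ] S d d) + proj₁ pairing * 2) % 2 ≡⟨ [m+kn]%n≡m%n (∑[ d ∈ D ] S d d) (proj₁ pairing) 2 ⟩
  (∑[ d ∈ D ] S d d) % 2                     ≡⟨ cong (_% 2) (∑-cong D diagonal) ⟩
  (∑[ d ∈ D ] 𝟙 (d ≟ m)) % 2                 ≡⟨ cong (_% 2) (∑-𝟙-≟-range1 L (>-nonZero⁻¹ m) (≤-trans (m≤m*n m m) m²≤L)) ⟩
  1                                          ∎
  where
  open ≡-Reasoning
  instance
    m*m≢0 : NonZero (m * m)
    m*m≢0 = m*n≢0 m m
  D = range1 L
  S : ℕ → ℕ → ℕ
  S d e = 𝟙 (d * e ≟ m * m)
  pairing = ∑∑-symmetric S (λ d e → 𝟙-cong (trans (*-comm e d)) (trans (*-comm d e)) (d * e ≟ m * m) (e * d ≟ m * m)) D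
  diagonal : ∀ d → S d d ≡ 𝟙 (d ≟ m)
  diagonal d = 𝟙-cong (m*m≡n*n⇒m≡n d m) (cong (λ t → t * t)) (d * d ≟ m * m) (d ≟ m)

parity : ∀ m → m % 2 ≡ 0 ⊎ m % 2 ≡ 1
parity m with m % 2 | m%n<n m 2
... | 0           | _ = inj₁ refl
... | 1           | _ = inj₂ refl
... | suc (suc _) | s≤s (s≤s ())

[2*m]%2≡0 : ∀ m → (2 * m) % 2 ≡ 0
[2*m]%2≡0 m = trans (cong (_% 2) (*-comm 2 m)) (m*n%n≡0 m 2)

[m*n]%2≡0 : ∀ m {n} → n % 2 ≡ 0 → (m * n) % 2 ≡ 0
[m*n]%2≡0 m {n} n-even = n∣m⇒m%n≡0 (m * n) 2 (∣n⇒∣m*n m (m%n≡0⇒n∣m n 2 n-even))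

[m*n]%2≡m%2 : ∀ m {n} → n % 2 ≡ 1 → (m * n) % 2 ≡ m % 2
[m*n]%2≡m%2 m {n} n-odd = begin
  (m * n) % 2               ≡⟨ %-distribˡ-* m n 2 ⟩
  (m % 2 * (n % 2)) % 2     ≡⟨ cong (λ t → (m % 2 * t) % 2) n-odd ⟩
  (m % 2 * 1) % 2           ≡⟨ cong (_% 2) (*-identityʳ (m % 2)) ⟩
  m % 2 % 2                 ≡⟨ m%n%n≡m%n m 2 ⟩
  m % 2                     ∎
  where open ≡-Reasoning

m^[1+n]%2≡m%2 : ∀ m n → m ^ suc n % 2 ≡ m % 2
m^[1+n]%2≡m%2 m zero = cong (_% 2) (*-identityʳ m)
m^[1+n]%2≡m%2 m (suc n) with parity m
... | inj₁ m-even = trans ([m*n]%2≡0 m (trans (m^[1+n]%2≡m%2 m n) m-even)) (sym m-even)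
... | inj₂ m-odd  = [m*n]%2≡m%2 m (trans (m^[1+n]%2≡m%2 m n) m-odd)

odd⇒coprime-2 : ∀ {m} → m % 2 ≡ 1 → Coprime m 2
odd⇒coprime-2 m-odd {zero}        (_ , 0∣2)   = contradiction (0∣⇒≡0 0∣2) λ ()
odd⇒coprime-2 m-odd {1}           _           = refl
odd⇒coprime-2 m-odd {2}           (2∣m , _)   = contradiction (trans (sym (n∣m⇒m%n≡0 _ 2 2∣m)) m-odd) λ ()
odd⇒coprime-2 m-odd {suc (suc (suc _))} (_ , d∣2) with ∣⇒≤ d∣2
... | s≤s (s≤s ())

odd∣2^k*n⇒∣n : ∀ k {m n} → m % 2 ≡ 1 → m ∣ 2 ^ k * n → m ∣ n
odd∣2^k*n⇒∣n zero    {m} {n} m-odd m∣n = subst (m ∣_) (*-identityˡ n) m∣n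
odd∣2^k*n⇒∣n (suc k) {m} {n} m-odd m∣2ᵏ⁺¹n = odd∣2^k*n⇒∣n k m-odd
  (coprime-divisor (odd⇒coprime-2 m-odd) (subst (m ∣_) (*-assoc 2 (2 ^ k) n) m∣2ᵏ⁺¹n))

m%2≡0⇒m≡[m/2]*2 : ∀ m → m % 2 ≡ 0 → m ≡ m / 2 * 2
m%2≡0⇒m≡[m/2]*2 m m-even = trans (m≡m%n+[m/n]*n m 2) (cong (_+ m / 2 * 2) m-even)

odd-part : ∀ m .{{_ : NonZero m}} → ∃₂ λ k o → m ≡ 2 ^ k * o × o % 2 ≡ 1
odd-part = <-rec P split
  where
  P : ℕ → Set
  P m = .{{_ : NonZero m}} → ∃₂ λ k o → m ≡ 2 ^ k * o × o % 2 ≡ 1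
  split : ∀ m → (∀ {h} → h < m → P h) → P m
  split m rec with parity m
  ... | inj₂ m-odd  = 0 , m , sym (*-identityˡ m) , m-odd
  ... | inj₁ m-even = double (rec h<m)
    where
    h = m / 2
    m≡h*2 : m ≡ h * 2
    m≡h*2 = m%2≡0⇒m≡[m/2]*2 m m-even
    instance
      h≢0 : NonZero h
      h≢0 = m*n≢0⇒m≢0 h {{subst NonZero m≡h*2 it}}
    h<m : h < m
    h<m = subst (h <_) (sym m≡h*2) (m<m*n h 2 ≤-refl)
    double : ∃₂ (λ k o → h ≡ 2 ^ k * o × o % 2 ≡ 1) → ∃₂ λ k o → m ≡ 2 ^ k * o × o % 2 ≡ 1
    double (k , o , h≡2ᵏo , o-odd) =
      suc k , o , trans m≡h*2 (trans (cong (_* 2) h≡2ᵏo) (trans (*-comm (2 ^ k * o) 2) (sym (*-assoc 2 (2 ^ k) o)))) , o-odd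

odd≢2* : ∀ m n → m % 2 ≡ 1 → m ≢ 2 * n
odd≢2* m n m-odd refl = 0≢1+n (trans (sym ([2*m]%2≡0 n)) m-odd)

2*odd≢square : ∀ m n → m % 2 ≡ 1 → 2 * m ≢ n * n
2*odd≢square m n m-odd 2m≡n² with parity n
... | inj₂ n-odd  = odd≢2* (n * n) m (trans ([m*n]%2≡m%2 n n-odd) n-odd) (sym 2m≡n²)
... | inj₁ n-even = odd≢2* m (h * h) m-odd
  (*-cancelˡ-≡ m (2 * (h * h)) 2 (trans 2m≡n² (trans (cong (λ t → t * t) (m%2≡0⇒m≡[m/2]*2 n n-even)) (quadruple h))))
  where
  h = n / 2
  quadruple : ∀ h → h * 2 * (h * 2) ≡ 2 * (2 * (h * h))
  quadruple = solve-∀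

^-distribʳ-* : ∀ m n k → (m * n) ^ k ≡ m ^ k * n ^ k
^-distribʳ-* m n zero    = refl
^-distribʳ-* m n (suc k) rewrite ^-distribʳ-* m n k = interchange m n (m ^ k) (n ^ k)
  where
  interchange : ∀ a b c d → a * b * (c * d) ≡ a * c * (b * d)
  interchange = solve-∀

σ≡∑ : ∀ a n → σ a n ≡ ∑[ d ∈ range1 n ] 𝟙 (d ∣? n) * d ^ a
σ≡∑ a n = sum-map-filter (_∣? n) (_^ a) (range1 n)

σ-suc≡oddDivisorCount : ∀ a j {N M} → N ≡ 2 ^ j * M → M % 2 ≡ 1 →
                        σ (suc a) N % 2 ≡ (∑[ d ∈ range1 N ] 𝟙 (d ∣? M)) % 2
σ-suc≡oddDivisorCount a j {N} {M} N≡2ʲM M-odd =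
  trans (cong (_% 2) (σ≡∑ (suc a) N)) (∑-cong-% 2 (range1 N) term)
  where
  term : ∀ d → (𝟙 (d ∣? N) * d ^ suc a) % 2 ≡ 𝟙 (d ∣? M) % 2
  term d with parity d
  ... | inj₁ d-even = trans ([m*n]%2≡0 (𝟙 (d ∣? N)) (trans (m^[1+n]%2≡m%2 d a) d-even))
                            (cong (_% 2) (sym (𝟙-¬ d∤M (d ∣? M))))
    where
    d∤M : ¬ d ∣ M
    d∤M d∣M = 0≢1+n (trans (sym (n∣m⇒m%n≡0 M 2 (∣-trans (m%n≡0⇒n∣m d 2 d-even) d∣M))) M-odd)
  ... | inj₂ d-odd  = trans ([m*n]%2≡m%2 (𝟙 (d ∣? N)) (trans (m^[1+n]%2≡m%2 d a) d-odd))
                            (cong (_% 2) (𝟙-cong d∣N⇒d∣M d∣M⇒d∣N (d ∣? N) (d ∣? M)))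
    where
    d∣N⇒d∣M : d ∣ N → d ∣ M
    d∣N⇒d∣M d∣N = odd∣2^k*n⇒∣n j d-odd (subst (d ∣_) N≡2ʲM d∣N)
    d∣M⇒d∣N : d ∣ M → d ∣ N
    d∣M⇒d∣N d∣M = ∣-trans d∣M (divides (2 ^ j) N≡2ʲM)

σ-square-odd : ∀ a m .{{_ : NonZero m}} → σ a (m * m) % 2 ≡ 1
σ-square-odd zero m = begin
  σ 0 (m * m) % 2                                  ≡⟨ cong (_% 2) (σ≡∑ 0 (m * m)) ⟩
  (∑[ d ∈ range1 (m * m) ] 𝟙 (d ∣? m * m) * 1) % 2 ≡⟨ cong (_% 2) (∑-cong (range1 (m * m)) (λ d → *-identityʳ _)) ⟩
  (∑[ d ∈ range1 (m * m) ] 𝟙 (d ∣? m * m)) % 2     ≡⟨ divisorCount-square-odd (m * m) m ≤-refl ⟩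
  1                                                ∎
  where open ≡-Reasoning
σ-square-odd (suc a) m with odd-part m
... | k , o , m≡2ᵏo , o-odd = begin
  σ (suc a) (m * m) % 2                         ≡⟨ σ-suc≡oddDivisorCount a (k + k) m²≡2²ᵏo² o²-odd ⟩
  (∑[ d ∈ range1 (m * m) ] 𝟙 (d ∣? o * o)) % 2  ≡⟨ divisorCount-square-odd (m * m) o o²≤m² ⟩
  1                                             ∎
  where
  open ≡-Reasoning
  instance
    o≢0 : NonZero o
    o≢0 = m*n≢0⇒n≢0 (2 ^ k) {{subst NonZero m≡2ᵏo it}}
    m*m≢0 : NonZero (m * m)
    m*m≢0 = m*n≢0 m m
  m²≡2²ᵏo² : m * m ≡ 2 ^ (k + k) * (o * o)
  m²≡2²ᵏo² = begin
    m * m                         ≡⟨ cong (λ t → t * t) m≡2ᵏo ⟩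
    2 ^ k * o * (2 ^ k * o)       ≡⟨ interchange (2 ^ k) o ⟩
    2 ^ k * 2 ^ k * (o * o)       ≡⟨ cong (_* (o * o)) (^-distribˡ-+-* 2 k k) ⟨
    2 ^ (k + k) * (o * o)         ∎
    where
    interchange : ∀ x y → x * y * (x * y) ≡ x * x * (y * y)
    interchange = solve-∀
  o²-odd : (o * o) % 2 ≡ 1
  o²-odd = trans ([m*n]%2≡m%2 o o-odd) o-odd
  o²≤m² : o * o ≤ m * m
  o²≤m² = ∣⇒≤ (divides (2 ^ (k + k)) m²≡2²ᵏo²)

coprime∧max≡2 : ∀ {α₁ α₂} → Coprime α₁ α₂ → 1 ≤ α₁ → 1 ≤ α₂ → 2 ≤ α₁ ⊔ α₂ → α₁ ⊔ α₂ ≤ 2 →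
                (α₁ ≡ 2 × α₂ ≡ 1) ⊎ (α₁ ≡ 1 × α₂ ≡ 2)
coprime∧max≡2 {α₁} {α₂} α₁⊥α₂ 1≤α₁ 1≤α₂ 2≤⊔ ⊔≤2 =
  cases α₁ α₂ α₁⊥α₂ 1≤α₁ 1≤α₂ (≤-trans (m≤m⊔n α₁ α₂) ⊔≤2) (≤-trans (m≤n⊔m α₁ α₂) ⊔≤2) 2≤⊔
  where
  cases : ∀ α₁ α₂ → Coprime α₁ α₂ → 1 ≤ α₁ → 1 ≤ α₂ → α₁ ≤ 2 → α₂ ≤ 2 → 2 ≤ α₁ ⊔ α₂ →
          (α₁ ≡ 2 × α₂ ≡ 1) ⊎ (α₁ ≡ 1 × α₂ ≡ 2)
  cases 1 1 _   _ _ _ _ (s≤s ())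
  cases 1 2 _   _ _ _ _ _ = inj₂ (refl , refl)
  cases 2 1 _   _ _ _ _ _ = inj₁ (refl , refl)
  cases 2 2 2⊥2 _ _ _ _ _ = contradiction (2⊥2 (∣-refl , ∣-refl)) λ ()
  cases (suc (suc (suc _))) _ _ _ _ (s≤s (s≤s ())) _ _
  cases _ (suc (suc (suc _))) _ _ _ _ (s≤s (s≤s ())) _

theorem3p9 : (a b n : ℕ) → StrongAlpha a b n → ω n ≤ 2 → ¬ IsSquare n
theorem3p9 a b .(m * m) (1≤n , α₁ , α₂ , 1≤α₁ , 1≤α₂ , α₁⊥α₂ , α₂σ≡α₁nᵇ , 2≤⊔ , ⊔≤ω) ω≤2 (m , refl)
  with coprime∧max≡2 α₁⊥α₂ 1≤α₁ 1≤α₂ 2≤⊔ (≤-trans ⊔≤ω ω≤2)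
     | σ-square-odd a m {{m*n≢0⇒m≢0 m {{>-nonZero 1≤n}}}}
... | inj₁ (refl , refl) | σ-odd = odd≢2* (σ a (m * m)) ((m * m) ^ b) σ-odd (trans (sym (*-identityˡ _)) α₂σ≡α₁nᵇ)
... | inj₂ (refl , refl) | σ-odd = 2*odd≢square (σ a (m * m)) (m ^ b) σ-odd (begin
  2 * σ a (m * m)     ≡⟨ α₂σ≡α₁nᵇ ⟩
  1 * (m * m) ^ b     ≡⟨ *-identityˡ _ ⟩
  (m * m) ^ b         ≡⟨ ^-distribʳ-* m m b ⟩
  m ^ b * m ^ b       ∎)
  where open ≡-Reasoning
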